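{- Let $(N,\chi)$ be a weighted game with exactly two types of voters ($t=2$) having exactly one shift-minimal winning coalition ($r=1$). Then the game has a unique minimum integer representation.
   Context: A simple game on $N=\{1,\dots,n\}$ is a map $\chi:2^N\to\{0,1\}$ with $\chi(\emptyset)=0$, $\chi(N)=1$ and monotone; weighted if there are non-negative weights $w_i$ and quota $q$ with $U$ winning iff $\sum_{i\in U}w_i\ge q$. Types are the equivalence classes of Isbell's desirability relation ($i$ at least as desirable as $j$ iff replacing $j$ by $i$ in any coalition containing $j$ but not $i$ never turns winning into losing). With two types $N_1$ (more desirable) and $N_2$, coalitions are described by vectors $(m_1,m_2)$ of member counts; the order $\preceq$ is generated by $(m_1-1,m_2)\preceq(m_1,m_2)$, $(m_1,m_2-1)\preceq(m_1,m_2)$, $(m_1-1,m_2+1)\preceq(m_1,m_2)$, and shift-minimal winning coalitions are the $\preceq$-minimal winning vectors. An integer representation $[q;w_1,\dots,w_n]$ has non-negative integer weights and integer quota with winning coalitions of weight $\ge q$ and losing ones of weight $\le q-1$; it is a minimum integer representation if $w_i\le w_i'$ for all $i$ for every integer representation $[q';w']$ of the same game.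
   Formalization: The non-negative weights $w_i$ and quota $q$ that make the game weighted are taken to be rational. -}

module Defs where

open import Data.Nat as ℕ using (ℕ; zero; suc)
open import Data.Rational as ℚ using (ℚ)
open import Data.Bool using (Bool; true; false; if_then_else_; _∧_; not)
open import Data.Fin using (Fin; zero; suc; _≟_)
open import Data.Product using (Σ; _×_; _,_; ∃)
open import Relation.Binary.PropositionalEquality using (_≡_)
open import Relation.Nullary using (¬_; yes; no)
open import Relation.Binary.Construct.Closure.ReflexiveTransitive using (Star)
open import Function.Bundles using (_⇔_)

Coalition : ℕ → Set
Coalition n = Fin n → Bool

Game : ℕ → Set
Game n = Coalition n → Bool

∅c : ∀ {n} → Coalition n
∅c _ = false

Nc : ∀ {n} → Coalition n
Nc _ = true

_⊆c_ : ∀ {n} → Coalition n → Coalition n → Set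
U ⊆c V = ∀ i → U i ≡ true → V i ≡ true

IsSimpleGame : ∀ {n} → Game n → Set
IsSimpleGame χ =
  χ ∅c ≡ false × χ Nc ≡ true ×
  (∀ U V → U ⊆c V → χ U ≡ true → χ V ≡ true)

wsumℚ : ∀ {n} → (Fin n → ℚ) → Coalition n → ℚ
wsumℚ {zero}  w U = ℚ.0ℚ
wsumℚ {suc n} w U =
  (if U zero then w zero else ℚ.0ℚ) ℚ.+ wsumℚ (λ i → w (suc i)) (λ i → U (suc i))

wsumℕ : ∀ {n} → (Fin n → ℕ) → Coalition n → ℕ
wsumℕ {zero}  w U = 0
wsumℕ {suc n} w U =
  (if U zero then w zero else 0) ℕ.+ wsumℕ (λ i → w (suc i)) (λ i → U (suc i))

count : ∀ {n} → Coalition n → ℕ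
count U = wsumℕ (λ _ → 1) U

IsWeighted : ∀ {n} → Game n → Set
IsWeighted {n} χ =
  Σ (Fin n → ℚ) λ w → Σ ℚ λ q →
    (∀ i → ℚ.0ℚ ℚ.≤ w i) ×
    (∀ U → (χ U ≡ true) ⇔ (q ℚ.≤ wsumℚ w U))

IsIntRep : ∀ {n} → Game n → ℕ → (Fin n → ℕ) → Set
IsIntRep χ q w =
  ∀ U → (χ U ≡ true → q ℕ.≤ wsumℕ w U) × (χ U ≡ false → wsumℕ w U ℕ.< q)

IsMinIntRep : ∀ {n} → Game n → ℕ → (Fin n → ℕ) → Set
IsMinIntRep {n} χ q w =
  IsIntRep χ q w × (∀ q' (w' : Fin n → ℕ) → IsIntRep χ q' w' → ∀ i → w i ℕ.≤ w' i)

swapIn : ∀ {n} → Fin n → Fin n → Coalition n → Coalition n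
swapIn i j U k with k ≟ i | k ≟ j
... | yes _ | _     = true
... | no _  | yes _ = false
... | no _  | no _  = U k

_⊒[_]_ : ∀ {n} → Fin n → Game n → Fin n → Set
i ⊒[ χ ] j = ∀ U → U j ≡ true → U i ≡ false → χ U ≡ true → χ (swapIn i j U) ≡ true

_≈[_]_ : ∀ {n} → Fin n → Game n → Fin n → Set
i ≈[ χ ] j = (i ⊒[ χ ] j) × (j ⊒[ χ ] i)

-- t classifies players into exactly two types: the types (equivalence
-- classes of ≈) are exactly t⁻¹(true) = N₁ and t⁻¹(false) = N₂, both
-- nonempty, and N₁ is the more desirable type.
IsTwoTypes : ∀ {n} → Game n → (Fin n → Bool) → Set
IsTwoTypes χ t =
  (∀ i j → (i ≈[ χ ] j) ⇔ (t i ≡ t j)) ×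
  (∃ λ i → t i ≡ true) × (∃ λ j → t j ≡ false) ×
  (∀ i j → t i ≡ true → t j ≡ false → i ⊒[ χ ] j)

m₁ : ∀ {n} → (Fin n → Bool) → Coalition n → ℕ
m₁ t U = count (λ k → U k ∧ t k)

m₂ : ∀ {n} → (Fin n → Bool) → Coalition n → ℕ
m₂ t U = count (λ k → U k ∧ not (t k))

Vec2 : Set
Vec2 = ℕ × ℕ

data Step : Vec2 → Vec2 → Set where
  dec₁  : ∀ {a b} → Step (a , b) (suc a , b)
  dec₂  : ∀ {a b} → Step (a , b) (a , suc b)
  shift : ∀ {a b} → Step (a , suc b) (suc a , b)

_⪯_ : Vec2 → Vec2 → Set
_⪯_ = Star Step

WinVec : ∀ {n} → Game n → (Fin n → Bool) → Vec2 → Set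
WinVec χ t (a , b) = ∃ λ U → m₁ t U ≡ a × m₂ t U ≡ b × χ U ≡ true

IsShiftMinWin : ∀ {n} → Game n → (Fin n → Bool) → Vec2 → Set
IsShiftMinWin χ t v = WinVec χ t v × (∀ v' → WinVec χ t v' → v' ⪯ v → v' ≡ v)

ExactlyOneShiftMinWin : ∀ {n} → Game n → (Fin n → Bool) → Set
ExactlyOneShiftMinWin χ t =
  ∃ λ v → IsShiftMinWin χ t v × (∀ v' → IsShiftMinWin χ t v' → v' ≡ v)

-- Players of one type are interchangeable and a type-1 player may always replace a type-2
-- player, so swapping members shows that a coalition wins as soon as it has at least as many
-- type-1 members and at least as many members as a winning one. With (a , b) the unique
-- shift-minimal winning vector, U therefore wins iff m₁ U ≥ a and |U| ≥ a + b.
-- A weighted game admits no trade of two losing coalitions for two winning ones; trading one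
-- type-1 player for two type-2 players around (a , b) shows that d = n₂ - b is 1 as soon as
-- k = min (n₁ - a) (b - 1) is positive. Then type-2 weight W₂ = k + 1 (0 if b = 0), type-1
-- weight W₁ = W₂ d + 1 and quota W₁ a + W₂ b represent the game. Conversely, exchanging
-- players between a winning and a losing coalition forces every integer representation to
-- give type-2 players weight above k and type-1 players weight at least W₂ d + 1, so this
-- representation is the minimum one, and the minimum is unique.
module Submission where

open import Defs
open import Data.Nat using (ℕ; zero; suc; pred; _+_; _*_; _∸_; _⊓_; _≤_; _<_; _<ᵇ_; z≤n; s≤s)
import Data.Nat.Properties as ℕ
open import Data.Nat.Induction using (<-wellFounded)
open import Data.Nat.Solver using (module +-*-Solver)
open import Data.Rational using (ℚ; 0ℚ) renaming (_+_ to _ℚ+_; _≤_ to _ℚ≤_; _<_ to _ℚ<_)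
import Data.Rational.Properties as ℚ
open import Data.Bool using (Bool; true; false; _∧_; _∨_; not; if_then_else_)
import Data.Bool.Properties as Bool
open import Data.Fin using (Fin; zero; suc; _≟_)
open import Data.Product using (Σ; _×_; _,_; ∃; proj₁; proj₂)
open import Data.Product.Properties using (≡-dec)
open import Data.Sum using (_⊎_; inj₁; inj₂; [_,_]′)
open import Data.Empty using (⊥; ⊥-elim)
open import Algebra.Bundles using (CommutativeMonoid)
open import Function.Bundles using (Equivalence)
open import Induction.WellFounded using (Acc; acc)
open import Relation.Binary.PropositionalEquality
  using (_≡_; _≢_; _≗_; refl; sym; trans; cong; cong₂; subst; subst₂; module ≡-Reasoning)
open import Relation.Binary.Construct.Closure.ReflexiveTransitive using (ε; _◅_; _◅◅_)
open import Relation.Nullary using (Dec; ¬_; does; yes; no; contradiction)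
open import Relation.Nullary.Decidable using (dec-true; map′; _⊎-dec_; _×-dec_)
open import Relation.Unary using (Decidable)

open +-*-Solver using (solve; _:+_; _:*_; _:=_; con)

-- Coalitions as sets and multisets

ind : Bool → ℕ
ind true  = 1
ind false = 0

∧≡true : ∀ {x y} → x ∧ y ≡ true → x ≡ true × y ≡ true
∧≡true {true} {true} _ = refl , refl

∖≡true : ∀ {x y} → x ∧ not y ≡ true → x ≡ true × y ≡ false
∖≡true {true} {false} _ = refl , refl

not≡true : ∀ {x} → not x ≡ true → x ≡ false
not≡true {false} _ = refl

∧-intro : ∀ {x y} → x ≡ true → y ≡ true → x ∧ y ≡ true
∧-intro refl refl = refl

≤-balance : ∀ {x y a b} → x + b ≡ y + a → x ≤ y → a ≤ b
≤-balance {x} {y} {a} {b} eq x≤y = ℕ.+-cancelˡ-≤ y a b (subst (_≤ y + b) eq (ℕ.+-monoˡ-≤ b x≤y))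

<-balance : ∀ {x y a b} → x + b ≡ y + a → a < b → x < y
<-balance {x} {y} {a} {b} eq = ≤-balance balanced
  where
  open ≡-Reasoning
  balanced : suc a + y ≡ b + suc x
  balanced = begin
    suc (a + y) ≡⟨ cong suc (trans (ℕ.+-comm a y) (sym eq)) ⟩
    suc (x + b) ≡⟨ cong suc (ℕ.+-comm x b) ⟩
    suc (b + x) ≡⟨ sym (ℕ.+-suc b x) ⟩
    b + suc x   ∎

module _ {n : ℕ} where

  infix  25 ∁_
  infixr 7 _∩_
  infixr 6 _∪_ _∖_
  infixl 6 _⊕_

  ∁_ : Coalition n → Coalition n
  (∁ A) k = not (A k)

  _∪_ _∩_ _∖_ : Coalition n → Coalition n → Coalition n
  (A ∪ B) k = A k ∨ B k
  (A ∩ B) k = A k ∧ B k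
  (A ∖ B) k = A k ∧ not (B k)

  ⁅_⁆ : Fin n → Coalition n
  ⁅ p ⁆ k = does (k ≟ p)

  Disjoint : Coalition n → Coalition n → Set
  Disjoint A B = ∀ k → A k ≡ true → B k ≡ false

  -- A ⊕ B ≗ C ⊕ D says that A, B and C, D are the same multiset of players.
  _⊕_ : Coalition n → Coalition n → Fin n → ℕ
  (A ⊕ B) k = ind (A k) + ind (B k)

  ⁅⁆-self : ∀ p → ⁅ p ⁆ p ≡ true
  ⁅⁆-self p = dec-true (p ≟ p) refl

  ⁅⁆-sole : ∀ {p k} → ⁅ p ⁆ k ≡ true → k ≡ p
  ⁅⁆-sole {p} {k} e with k ≟ p
  ... | yes k≡p = k≡p

  ⊕-∪ : ∀ {A B} → Disjoint A B → (A ∪ B) ⊕ ∅c ≗ A ⊕ B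
  ⊕-∪ {A} {B} disj k with A k in eA | B k in eB
  ... | true  | true  = contradiction (trans (sym eB) (disj k eA)) λ ()
  ... | true  | false = refl
  ... | false | true  = refl
  ... | false | false = refl

  ⊕-∖ : ∀ {A B} → B ⊆c A → A ⊕ ∅c ≗ B ⊕ (A ∖ B)
  ⊕-∖ {A} {B} B⊆A k with A k in eA | B k in eB
  ... | true  | true  = refl
  ... | true  | false = refl
  ... | false | true  = contradiction (trans (sym (B⊆A k eB)) eA) λ ()
  ... | false | false = refl

  ⊕-split : ∀ A X → A ⊕ ∅c ≗ (A ∩ X) ⊕ (A ∖ X)
  ⊕-split A X k with A k | X k
  ... | true  | true  = refl
  ... | true  | false = refl
  ... | false | _     = refl

∖⁅⁆-self : ∀ {n} (X : Coalition n) j → (X ∖ ⁅ j ⁆) j ≡ false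
∖⁅⁆-self X j = trans (cong (λ b → X j ∧ not b) (⁅⁆-self j)) (Bool.∧-zeroʳ (X j))

-- The first m members of S in the order of Fin n (all of S when m exceeds its size).
firstOf : ∀ {n} → Coalition n → ℕ → Coalition n
firstOf {suc n} S m zero    = S zero ∧ (0 <ᵇ m)
firstOf {suc n} S m (suc k) = firstOf (λ i → S (suc i)) (if S zero then pred m else m) k

firstOf-⊆ : ∀ {n} (S : Coalition n) m → firstOf S m ⊆c S
firstOf-⊆ {suc n} S m zero    e with S zero
... | true = refl
firstOf-⊆ {suc n} S m (suc k) e = firstOf-⊆ (λ i → S (suc i)) _ k e

count-firstOf : ∀ {n} (S : Coalition n) {m} → m ≤ count S → count (firstOf S m) ≡ m
count-firstOf {zero}  S {zero} m≤ = refl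
count-firstOf {suc n} S {m} m≤ with S zero
count-firstOf {suc n} S {zero}  m≤       | true  = count-firstOf (λ i → S (suc i)) z≤n
count-firstOf {suc n} S {suc m} (s≤s m≤) | true  = cong suc (count-firstOf (λ i → S (suc i)) m≤)
count-firstOf {suc n} S {m}     m≤       | false = count-firstOf (λ i → S (suc i)) m≤

firstOf-mono : ∀ {n} (S : Coalition n) {m m′} → m ≤ m′ → firstOf S m ⊆c firstOf S m′
firstOf-mono {suc n} S {suc m} {suc m′} m≤m′ zero e = e
firstOf-mono {suc n} S {zero}           m≤m′ zero e with S zero | e
... | true  | ()
... | false | ()
firstOf-mono {suc n} S m≤m′ (suc k) e with S zero
... | true  = firstOf-mono (λ i → S (suc i)) (ℕ.∸-monoˡ-≤ 1 m≤m′) k e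
... | false = firstOf-mono (λ i → S (suc i)) m≤m′ k e

⊕-chain : ∀ {n} {A B C : Coalition n} → A ⊆c B → B ⊆c C → A ⊕ C ≗ B ⊕ (A ∪ (C ∖ B))
⊕-chain {A = A} {B} {C} A⊆B B⊆C k with A k in Ak | B k in Bk | C k in Ck
... | true  | false | _     = contradiction (trans (sym (A⊆B k Ak)) Bk) λ ()
... | _     | true  | false = contradiction (trans (sym (B⊆C k Bk)) Ck) λ ()
... | true  | true  | true  = refl
... | false | true  | true  = refl
... | false | false | true  = refl
... | false | false | false = refl

⊕-∪-∖ : ∀ {n} {A B C : Coalition n} → Disjoint A C → B ⊆c C → (A ∪ C) ⊕ ∅c ≗ (C ∖ B) ⊕ (A ∪ B)
⊕-∪-∖ {A = A} {B} {C} A∩C≡∅ B⊆C k with A k in Ak | B k in Bk | C k in Ck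
... | true  | _     | true  = contradiction (trans (sym Ck) (A∩C≡∅ k Ak)) λ ()
... | _     | true  | false = contradiction (trans (sym (B⊆C k Bk)) Ck) λ ()
... | true  | false | false = refl
... | false | true  | true  = refl
... | false | false | true  = refl
... | false | false | false = refl

⊕-∩ : ∀ {n} {A B C D : Coalition n} X → A ⊕ B ≗ C ⊕ D → (A ∩ X) ⊕ (B ∩ X) ≗ (C ∩ X) ⊕ (D ∩ X)
⊕-∩ {A = A} {B} {C} {D} X eq k with X k
... | true  rewrite Bool.∧-identityʳ (A k) | Bool.∧-identityʳ (B k) | Bool.∧-identityʳ (C k) | Bool.∧-identityʳ (D k) = eq k
... | false rewrite Bool.∧-zeroʳ (A k) | Bool.∧-zeroʳ (B k) | Bool.∧-zeroʳ (C k) | Bool.∧-zeroʳ (D k) = refl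

⊕-swapIn : ∀ {n} {U : Coalition n} {r p} → U p ≡ true → U r ≡ false → swapIn r p U ⊕ ⁅ p ⁆ ≗ U ⊕ ⁅ r ⁆
⊕-swapIn {U = U} {r} {p} Up Ur k with k ≟ r | k ≟ p
... | yes refl | yes refl = contradiction (trans (sym Up) Ur) λ ()
... | yes refl | no _     rewrite Ur = refl
... | no _     | yes refl rewrite Up = refl
... | no _     | no _     = refl

⊕-∖-exchange : ∀ {n} (U V : Coalition n) → U ⊕ (V ∖ U) ≗ V ⊕ (U ∖ V)
⊕-∖-exchange U V k with U k | V k
... | true  | true  = refl
... | true  | false = refl
... | false | true  = refl
... | false | false = refl

-- Weights of coalitions

module WeightSum {c ℓ} (M : CommutativeMonoid c ℓ) where

  open CommutativeMonoid M
    using (Carrier; _≈_; _∙_; identityˡ; identityʳ; ∙-cong; setoid; commutativeSemigroup)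
    renaming (ε to 0#; refl to ≈-refl; sym to ≈-sym; trans to ≈-trans; reflexive to ≈-reflexive)
  open import Algebra.Properties.CommutativeSemigroup commutativeSemigroup using (interchange)
  open import Relation.Binary.Reasoning.Setoid setoid

  member : Bool → Carrier → Carrier
  member b x = if b then x else 0#

  wsum : ∀ {n} → (Fin n → Carrier) → Coalition n → Carrier
  wsum {zero}  w U = 0#
  wsum {suc n} w U = member (U zero) (w zero) ∙ wsum (λ i → w (suc i)) (λ i → U (suc i))

  private
    multiple : ℕ → Carrier → Carrier
    multiple zero          x = 0#
    multiple (suc zero)    x = x
    multiple (suc (suc _)) x = x ∙ x

    member-pair : ∀ a b x → member a x ∙ member b x ≈ multiple (ind a + ind b) x
    member-pair true  true  x = ≈-refl
    member-pair true  false x = identityʳ x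
    member-pair false true  x = identityˡ x
    member-pair false false x = identityˡ 0#

  wsum-⊕ : ∀ {n} (w : Fin n → Carrier) {A B C D : Coalition n} →
    A ⊕ B ≗ C ⊕ D → wsum w A ∙ wsum w B ≈ wsum w C ∙ wsum w D
  wsum-⊕ {zero}  w eq = ≈-refl
  wsum-⊕ {suc n} w {A} {B} {C} {D} eq = begin
    (member (A zero) x ∙ wsum w′ A′) ∙ (member (B zero) x ∙ wsum w′ B′)
      ≈⟨ interchange _ _ _ _ ⟩
    (member (A zero) x ∙ member (B zero) x) ∙ (wsum w′ A′ ∙ wsum w′ B′)
      ≈⟨ ∙-cong (≈-trans (member-pair (A zero) (B zero) x)
                  (≈-trans (≈-reflexive (cong (λ m → multiple m x) (eq zero)))
                           (≈-sym (member-pair (C zero) (D zero) x))))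
                (wsum-⊕ w′ (λ k → eq (suc k))) ⟩
    (member (C zero) x ∙ member (D zero) x) ∙ (wsum w′ C′ ∙ wsum w′ D′)
      ≈⟨ interchange _ _ _ _ ⟩
    (member (C zero) x ∙ wsum w′ C′) ∙ (member (D zero) x ∙ wsum w′ D′) ∎
    where
    x : Carrier
    x = w zero
    w′ : Fin n → Carrier
    w′ i = w (suc i)
    A′ B′ C′ D′ : Coalition n
    A′ i = A (suc i)
    B′ i = B (suc i)
    C′ i = C (suc i)
    D′ i = D (suc i)

wsumℕ≡wsum : ∀ {n} (w : Fin n → ℕ) U → wsumℕ w U ≡ WeightSum.wsum ℕ.+-0-commutativeMonoid w U
wsumℕ≡wsum {zero}  w U = refl
wsumℕ≡wsum {suc n} w U = cong ((if U zero then w zero else 0) +_) (wsumℕ≡wsum (λ i → w (suc i)) (λ i → U (suc i)))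

wsumℚ≡wsum : ∀ {n} (w : Fin n → ℚ) U → wsumℚ w U ≡ WeightSum.wsum ℚ.+-0-commutativeMonoid w U
wsumℚ≡wsum {zero}  w U = refl
wsumℚ≡wsum {suc n} w U = cong ((if U zero then w zero else 0ℚ) ℚ+_) (wsumℚ≡wsum (λ i → w (suc i)) (λ i → U (suc i)))

wsumℕ-⊕ : ∀ {n} (w : Fin n → ℕ) {A B C D : Coalition n} →
  A ⊕ B ≗ C ⊕ D → wsumℕ w A + wsumℕ w B ≡ wsumℕ w C + wsumℕ w D
wsumℕ-⊕ w {A} {B} {C} {D} eq rewrite wsumℕ≡wsum w A | wsumℕ≡wsum w B | wsumℕ≡wsum w C | wsumℕ≡wsum w D =
  WeightSum.wsum-⊕ ℕ.+-0-commutativeMonoid w eq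

wsumℚ-⊕ : ∀ {n} (w : Fin n → ℚ) {A B C D : Coalition n} →
  A ⊕ B ≗ C ⊕ D → wsumℚ w A ℚ+ wsumℚ w B ≡ wsumℚ w C ℚ+ wsumℚ w D
wsumℚ-⊕ w {A} {B} {C} {D} eq rewrite wsumℚ≡wsum w A | wsumℚ≡wsum w B | wsumℚ≡wsum w C | wsumℚ≡wsum w D =
  WeightSum.wsum-⊕ ℚ.+-0-commutativeMonoid w eq

wsum-cong : ∀ {n} (w : Fin n → ℕ) {A B : Coalition n} → A ≗ B → wsumℕ w A ≡ wsumℕ w B
wsum-cong {zero}  w eq = refl
wsum-cong {suc n} w eq =
  cong₂ _+_ (cong (λ b → if b then w zero else 0) (eq zero)) (wsum-cong (λ i → w (suc i)) (λ k → eq (suc k)))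

wsum-∅ : ∀ {n} (w : Fin n → ℕ) → wsumℕ w ∅c ≡ 0
wsum-∅ {zero}  w = refl
wsum-∅ {suc n} w = wsum-∅ (λ i → w (suc i))

wsum-⁅⁆ : ∀ {n} (w : Fin n → ℕ) p → wsumℕ w ⁅ p ⁆ ≡ w p
wsum-⁅⁆ {suc n} w zero    = trans (cong (w zero +_) (wsum-∅ (λ i → w (suc i)))) (ℕ.+-identityʳ (w zero))
wsum-⁅⁆ {suc n} w (suc p) = wsum-⁅⁆ (λ i → w (suc i)) p

wsum-decompose : ∀ {n} (w : Fin n → ℕ) {A B C : Coalition n} →
  A ⊕ ∅c ≗ B ⊕ C → wsumℕ w A ≡ wsumℕ w B + wsumℕ w C
wsum-decompose w {A} eq =
  trans (sym (ℕ.+-identityʳ _)) (trans (cong (wsumℕ w A +_) (sym (wsum-∅ w))) (wsumℕ-⊕ w eq))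

wsum-∪ : ∀ {n} (w : Fin n → ℕ) {A B : Coalition n} → Disjoint A B → wsumℕ w (A ∪ B) ≡ wsumℕ w A + wsumℕ w B
wsum-∪ w disj = wsum-decompose w (⊕-∪ disj)

wsum-∖ : ∀ {n} (w : Fin n → ℕ) {A B : Coalition n} → B ⊆c A → wsumℕ w A ≡ wsumℕ w B + wsumℕ w (A ∖ B)
wsum-∖ w B⊆A = wsum-decompose w (⊕-∖ B⊆A)

wsum-split : ∀ {n} (w : Fin n → ℕ) (A X : Coalition n) → wsumℕ w A ≡ wsumℕ w (A ∩ X) + wsumℕ w (A ∖ X)
wsum-split w A X = wsum-decompose w (⊕-split A X)

wsum-mono : ∀ {n} (w : Fin n → ℕ) {A B : Coalition n} → A ⊆c B → wsumℕ w A ≤ wsumℕ w B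
wsum-mono w {A} {B} A⊆B = ℕ.≤-trans (ℕ.m≤m+n _ _) (ℕ.≤-reflexive (sym (wsum-∖ w A⊆B)))

wsum-member : ∀ {n} (w : Fin n → ℕ) {A : Coalition n} {k} → A k ≡ true → w k ≤ wsumℕ w A
wsum-member w {A} {k} Ak =
  subst (_≤ wsumℕ w A) (wsum-⁅⁆ w k) (wsum-mono w λ i e → subst (λ j → A j ≡ true) (sym (⁅⁆-sole e)) Ak)

wsum-monoʷ : ∀ {n} {w w′ : Fin n → ℕ} (A : Coalition n) →
  (∀ k → A k ≡ true → w k ≤ w′ k) → wsumℕ w A ≤ wsumℕ w′ A
wsum-monoʷ {zero}  A le = z≤n
wsum-monoʷ {suc n} A le with A zero in eA
... | true  = ℕ.+-mono-≤ (le zero eA) (wsum-monoʷ (λ i → A (suc i)) (λ k → le (suc k)))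
... | false = wsum-monoʷ (λ i → A (suc i)) (λ k → le (suc k))

wsum-congʷ : ∀ {n} {w w′ : Fin n → ℕ} (A : Coalition n) →
  (∀ k → A k ≡ true → w k ≡ w′ k) → wsumℕ w A ≡ wsumℕ w′ A
wsum-congʷ A eq =
  ℕ.≤-antisym (wsum-monoʷ A λ k e → ℕ.≤-reflexive (eq k e)) (wsum-monoʷ A λ k e → ℕ.≤-reflexive (sym (eq k e)))

wsum-const : ∀ {n} c (A : Coalition n) → wsumℕ (λ _ → c) A ≡ c * count A
wsum-const {zero}  c A = sym (ℕ.*-zeroʳ c)
wsum-const {suc n} c A with A zero
... | true  = trans (cong (c +_) (wsum-const c (λ i → A (suc i)))) (sym (ℕ.*-suc c _))
... | false = wsum-const c (λ i → A (suc i))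

wsum-lower : ∀ {n} {w : Fin n → ℕ} (A : Coalition n) {c} → (∀ k → A k ≡ true → c ≤ w k) → c * count A ≤ wsumℕ w A
wsum-lower A {c} c≤ = subst (_≤ _) (wsum-const c A) (wsum-monoʷ A c≤)

wsum-upper : ∀ {n} {w : Fin n → ℕ} (A : Coalition n) {c} → (∀ k → A k ≡ true → w k ≤ c) → wsumℕ w A ≤ c * count A
wsum-upper A {c} ≤c = subst (_ ≤_) (wsum-const c A) (wsum-monoʷ A ≤c)

count-pos : ∀ {n} (A : Coalition n) → 1 ≤ count A → ∃ λ k → A k ≡ true
count-pos {suc n} A pos with A zero in eA
... | true  = zero , eA
... | false with count-pos (λ i → A (suc i)) pos
...   | k , Ak = suc k , Ak

count-zero : ∀ {n} (A : Coalition n) → count A ≡ 0 → ∀ k → A k ≡ false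
count-zero A empty k with A k in eA
... | false = refl
... | true  = contradiction (ℕ.≤-trans (wsum-member (λ _ → 1) {A} eA) (ℕ.≤-reflexive empty)) λ ()

wsum-swapIn : ∀ {n} (w : Fin n → ℕ) {U : Coalition n} {r p} → U p ≡ true → U r ≡ false →
  wsumℕ w (swapIn r p U) + w p ≡ wsumℕ w U + w r
wsum-swapIn w {U} {r} {p} Up Ur = begin
  wsumℕ w (swapIn r p U) + w p             ≡⟨ cong (wsumℕ w (swapIn r p U) +_) (sym (wsum-⁅⁆ w p)) ⟩
  wsumℕ w (swapIn r p U) + wsumℕ w ⁅ p ⁆   ≡⟨ wsumℕ-⊕ w (⊕-swapIn Up Ur) ⟩
  wsumℕ w U + wsumℕ w ⁅ r ⁆                ≡⟨ cong (wsumℕ w U +_) (wsum-⁅⁆ w r) ⟩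
  wsumℕ w U + w r                           ∎
  where open ≡-Reasoning

count-∩ : ∀ {n} (U X : Coalition n) → count (U ∩ X) ≡ wsumℕ (λ k → ind (X k)) U
count-∩ {zero}  U X = refl
count-∩ {suc n} U X with U zero | X zero
... | true  | true  = cong suc (count-∩ (λ i → U (suc i)) (λ i → X (suc i)))
... | true  | false = count-∩ (λ i → U (suc i)) (λ i → X (suc i))
... | false | _     = count-∩ (λ i → U (suc i)) (λ i → X (suc i))

count-∩-swapIn : ∀ {n} {U : Coalition n} {r p} X → U p ≡ true → U r ≡ false →
  count (swapIn r p U ∩ X) + ind (X p) ≡ count (U ∩ X) + ind (X r)
count-∩-swapIn {U = U} {r} {p} X Up Ur
  rewrite count-∩ (swapIn r p U) X | count-∩ U X = wsum-swapIn (λ k → ind (X k)) Up Ur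

count-swapIn : ∀ {n} (U : Coalition n) {r p} → U p ≡ true → U r ≡ false → count (swapIn r p U) ≡ count U
count-swapIn {n} U Up Ur = ℕ.+-cancelʳ-≡ 1 _ _ (wsum-swapIn {n} (λ _ → 1) {U} Up Ur)

count-without : ∀ {n} {X : Coalition n} {j} → X j ≡ true → count X ≡ suc (count (X ∖ ⁅ j ⁆))
count-without {n} {X} {j} Xj =
  trans (wsum-∖ {n} (λ _ → 1) {X} {⁅ j ⁆} ⁅j⁆⊆X) (cong (_+ count (X ∖ ⁅ j ⁆)) (wsum-⁅⁆ (λ _ → 1) j))
  where
  ⁅j⁆⊆X : ⁅ j ⁆ ⊆c X
  ⁅j⁆⊆X k e = subst (λ i → X i ≡ true) (sym (⁅⁆-sole e)) Xj

least-in : ∀ {n} (P : Coalition n) (f : Fin n → ℕ) →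
  (∀ j → P j ≡ false) ⊎ ∃ λ j₀ → P j₀ ≡ true × ∀ j → P j ≡ true → f j₀ ≤ f j
least-in {zero}  P f = inj₁ λ ()
least-in {suc n} P f with least-in (λ i → P (suc i)) (λ i → f (suc i)) | P zero in P0
... | inj₁ none          | false = inj₁ λ { zero → P0 ; (suc j) → none j }
... | inj₁ none          | true  = inj₂ (zero , P0 , λ { zero _ → ℕ.≤-refl
                                                       ; (suc j) Pj → contradiction (trans (sym Pj) (none j)) λ () })
... | inj₂ (j₀ , Pj₀ , least) | false = inj₂ (suc j₀ , Pj₀ , λ { zero P0′ → contradiction (trans (sym P0′) P0) λ ()
                                                            ; (suc j) Pj → least j Pj })
... | inj₂ (j₀ , Pj₀ , least) | true with f zero ℕ.≤? f (suc j₀)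
...   | yes f0≤ = inj₂ (zero , P0 , λ { zero _ → ℕ.≤-refl ; (suc j) Pj → ℕ.≤-trans f0≤ (least j Pj) })
...   | no  f0≰ = inj₂ (suc j₀ , Pj₀ , λ { zero _ → ℕ.<⇒≤ (ℕ.≰⇒> f0≰) ; (suc j) Pj → least j Pj })

-- Representations of games

weighted⇒no-trade : ∀ {n} {χ : Game n} → IsWeighted χ → ∀ {A B C D} → A ⊕ B ≗ C ⊕ D →
  χ A ≡ false → χ B ≡ false → χ C ≡ true → χ D ≡ true → ⊥
weighted⇒no-trade {χ = χ} (w , q , _ , winning⇔) {A} {B} {C} {D} trade A-loses B-loses C-wins D-wins =
  ℚ.<-irrefl refl (begin-strict
    q ℚ+ q                    ≤⟨ ℚ.+-mono-≤ (wins C-wins) (wins D-wins) ⟩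
    wsumℚ w C ℚ+ wsumℚ w D    ≡⟨ sym (wsumℚ-⊕ w trade) ⟩
    wsumℚ w A ℚ+ wsumℚ w B    <⟨ ℚ.+-mono-< (loses A-loses) (loses B-loses) ⟩
    q ℚ+ q                    ∎)
  where
  open ℚ.≤-Reasoning
  wins : ∀ {U} → χ U ≡ true → q ℚ≤ wsumℚ w U
  wins = Equivalence.to (winning⇔ _)
  loses : ∀ {U} → χ U ≡ false → wsumℚ w U ℚ< q
  loses {U} U-loses = ℚ.≰⇒> λ q≤ → contradiction (trans (sym (Equivalence.from (winning⇔ U) q≤)) U-loses) λ ()

int-rep-exchange : ∀ {n} {χ : Game n} {q w} → IsIntRep χ q w → ∀ {W X L Y} → W ⊕ X ≗ L ⊕ Y →
  χ W ≡ true → χ L ≡ false → wsumℕ w X < wsumℕ w Y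
int-rep-exchange {w = w} rep {W} {X} {L} {Y} exchange W-wins L-loses =
  <-balance (trans (ℕ.+-comm (wsumℕ w X) (wsumℕ w W))
              (trans (wsumℕ-⊕ w {W} {X} {L} {Y} exchange) (ℕ.+-comm (wsumℕ w L) (wsumℕ w Y))))
            (ℕ.<-≤-trans (proj₂ (rep L) L-loses) (proj₁ (rep W) W-wins))

min-int-rep-unique : ∀ {n} {χ : Game n} {q q′ w w′} → IsMinIntRep χ q w → IsMinIntRep χ q′ w′ → ∀ i → w′ i ≡ w i
min-int-rep-unique {q = q} {q′} {w} {w′} (rep , least) (rep′ , least′) i =
  ℕ.≤-antisym (least′ q w rep i) (least q′ w′ rep′ i)

-- Type vectors

_≟²_ : (u v : Vec2) → Dec (u ≡ v)
_≟²_ = ≡-dec ℕ._≟_ ℕ._≟_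

infix 4 _≤²_ _⊑_

_≤²_ : Vec2 → Vec2 → Set
(x′ , y′) ≤² (x , y) = x′ ≤ x × y′ ≤ y

_⊑_ : Vec2 → Vec2 → Set
(x′ , y′) ⊑ (x , y) = x′ ≤ x × x′ + y′ ≤ x + y

⊑-trans : ∀ {u v w} → u ⊑ v → v ⊑ w → u ⊑ w
⊑-trans (x≤ , s≤) (x≤′ , s≤′) = ℕ.≤-trans x≤ x≤′ , ℕ.≤-trans s≤ s≤′

Step⇒⊑ : ∀ {u v} → Step u v → u ⊑ v
Step⇒⊑ (dec₁ {a} {b})  = ℕ.n≤1+n a , ℕ.n≤1+n (a + b)
Step⇒⊑ (dec₂ {a} {b})  = ℕ.≤-refl , ℕ.+-monoʳ-≤ a (ℕ.n≤1+n b)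
Step⇒⊑ (shift {a} {b}) = ℕ.n≤1+n a , ℕ.≤-reflexive (ℕ.+-suc a b)

⪯⇒⊑ : ∀ {u v} → u ⪯ v → u ⊑ v
⪯⇒⊑ ε        = ℕ.≤-refl , ℕ.≤-refl
⪯⇒⊑ (s ◅ ss) = ⊑-trans (Step⇒⊑ s) (⪯⇒⊑ ss)

⊑-Step : ∀ {B v v′} → v ≤² B → v′ ≤² B → v′ ⊑ v → v′ ≢ v → ∃ λ u → Step u v × u ≤² B × v′ ⊑ u
⊑-Step {v = x , y} {x′ , y′} (x≤ , y≤) (_ , y′≤) (x′≤x , s′≤s) v′≢v with x′ ℕ.<? x
⊑-Step {v = suc x , y} {x′ , y′} (x≤ , y≤) (_ , y′≤) (_ , s′≤s) _ | yes (s≤s x′≤x)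
  with (x′ + y′) ℕ.≤? (x + y)
... | yes s′≤ = (x , y) , dec₁ , (ℕ.≤-trans (ℕ.n≤1+n x) x≤ , y≤) , x′≤x , s′≤
... | no  s′≰ = (x , suc y) , shift , (ℕ.≤-trans (ℕ.n≤1+n x) x≤ , ℕ.≤-trans y<y′ y′≤) , x′≤x ,
                ℕ.≤-trans s′≤s (ℕ.≤-reflexive (sym (ℕ.+-suc x y)))
  where
  y<y′ : y < y′
  y<y′ = ℕ.≰⇒> λ y′≤y → s′≰ (ℕ.+-mono-≤ x′≤x y′≤y)
⊑-Step {v = x , y} {x′ , y′} (x≤ , y≤) _ (x′≤x , s′≤s) v′≢v | no x′≮x
  with ℕ.≤-antisym x′≤x (ℕ.≮⇒≥ x′≮x)
... | refl with ℕ.≤∧≢⇒< (ℕ.+-cancelˡ-≤ x y′ y s′≤s) (λ y′≡y → v′≢v (cong (x ,_) y′≡y))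
...   | s≤s {n = y₀} y′≤y₀ =
  (x , y₀) , dec₂ , (x≤ , ℕ.≤-trans (ℕ.n≤1+n y₀) y≤) , ℕ.≤-refl , ℕ.+-monoʳ-≤ x y′≤y₀

step-size : Vec2 → ℕ
step-size (x , y) = x + (x + y)

Step⇒step-size< : ∀ {u v} → Step u v → step-size u < step-size v
Step⇒step-size< (dec₁ {a} {b})  = s≤s (ℕ.+-monoʳ-≤ a (ℕ.n≤1+n (a + b)))
Step⇒step-size< (dec₂ {a} {b})  = ℕ.+-monoʳ-< a (ℕ.+-monoʳ-< a (ℕ.n<1+n b))
Step⇒step-size< (shift {a} {b}) = s≤s (ℕ.≤-reflexive (cong (a +_) (ℕ.+-suc a b)))

Step⁻¹? : ∀ {p} {P : Vec2 → Set p} → Decidable P → ∀ v → Dec (∃ λ u → Step u v × P u)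
Step⁻¹? P? (zero , zero)     = no λ { (_ , () , _) }
Step⁻¹? P? (zero , suc y)    = map′ (λ p → _ , dec₂ , p) (λ { (_ , dec₂ , p) → p }) (P? (zero , y))
Step⁻¹? P? (suc x , zero)    =
  map′ [ (λ p → _ , shift , p) , (λ p → _ , dec₁ , p) ]′
       (λ { (_ , shift , p) → inj₁ p ; (_ , dec₁ , p) → inj₂ p })
       (P? (x , 1) ⊎-dec P? (x , zero))
Step⁻¹? P? (suc x , suc y)   =
  map′ [ (λ p → _ , shift , p) , [ (λ p → _ , dec₁ , p) , (λ p → _ , dec₂ , p) ]′ ]′
       (λ { (_ , shift , p) → inj₁ p ; (_ , dec₁ , p) → inj₂ (inj₁ p) ; (_ , dec₂ , p) → inj₂ (inj₂ p) })
       (P? (x , suc (suc y)) ⊎-dec P? (x , suc y) ⊎-dec P? (suc x , y))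

-- Weighing type vectors

module _ where
  open ℕ.≤-Reasoning

  weigh-shift : ∀ {w₁ w₂} a {b} e y → w₂ ≤ w₁ → b ≤ e + y → w₁ * a + w₂ * b ≤ w₁ * (a + e) + w₂ * y
  weigh-shift {w₁} {w₂} a {b} e y w₂≤w₁ b≤ = begin
    w₁ * a + w₂ * b              ≤⟨ ℕ.+-monoʳ-≤ (w₁ * a) (ℕ.*-monoʳ-≤ w₂ b≤) ⟩
    w₁ * a + w₂ * (e + y)        ≡⟨ solve 5 (λ w₁ w₂ a e y → w₁ :* a :+ w₂ :* (e :+ y) := w₁ :* a :+ (w₂ :* e :+ w₂ :* y))
                                          refl w₁ w₂ a e y ⟩
    w₁ * a + (w₂ * e + w₂ * y)   ≤⟨ ℕ.+-monoʳ-≤ (w₁ * a) (ℕ.+-monoˡ-≤ (w₂ * y) (ℕ.*-monoˡ-≤ e w₂≤w₁)) ⟩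
    w₁ * a + (w₁ * e + w₂ * y)   ≡⟨ solve 5 (λ w₁ w₂ a e y → w₁ :* a :+ (w₁ :* e :+ w₂ :* y) := w₁ :* (a :+ e) :+ w₂ :* y)
                                          refl w₁ w₂ a e y ⟩
    w₁ * (a + e) + w₂ * y        ∎

  weigh-fewer-type₁ : ∀ w₂ d {a b x y} → x < a → y ≤ b + d →
    (w₂ * d + 1) * x + w₂ * y < (w₂ * d + 1) * a + w₂ * b
  weigh-fewer-type₁ w₂ d {a} {b} {x} {y} x<a y≤ = begin-strict
    (w₂ * d + 1) * x + w₂ * y           <⟨ s≤s (ℕ.+-monoʳ-≤ ((w₂ * d + 1) * x) (ℕ.*-monoʳ-≤ w₂ y≤)) ⟩
    suc ((w₂ * d + 1) * x + w₂ * (b + d)) ≡⟨ solve 4 (λ w d b x → con 1 :+ ((w :* d :+ con 1) :* x :+ w :* (b :+ d))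
                                                      := (w :* d :+ con 1) :* (con 1 :+ x) :+ w :* b) refl w₂ d b x ⟩
    (w₂ * d + 1) * suc x + w₂ * b       ≤⟨ ℕ.+-monoˡ-≤ (w₂ * b) (ℕ.*-monoʳ-≤ (w₂ * d + 1) x<a) ⟩
    (w₂ * d + 1) * a + w₂ * b           ∎

  weigh-fewer-members : ∀ w₁ k a {e y b} → w₁ * e ≤ suc k * e + k → suc (e + y) ≤ b →
    w₁ * (a + e) + suc k * y < w₁ * a + suc k * b
  weigh-fewer-members w₁ k a {e} {y} {b} w₁e≤ e+y<b = begin-strict
    w₁ * (a + e) + suc k * y                ≡⟨ solve 5 (λ w k a e y → w :* (a :+ e) :+ (con 1 :+ k) :* y
                                                         := w :* a :+ (w :* e :+ (con 1 :+ k) :* y)) refl w₁ k a e y ⟩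
    w₁ * a + (w₁ * e + suc k * y)            <⟨ ℕ.+-monoʳ-< (w₁ * a) (s≤s (ℕ.+-monoˡ-≤ (suc k * y) w₁e≤)) ⟩
    w₁ * a + suc (suc k * e + k + suc k * y) ≡⟨ solve 4 (λ w k e y → w :+ (con 1 :+ ((con 1 :+ k) :* e :+ k :+ (con 1 :+ k) :* y))
                                                         := w :+ (con 1 :+ k) :* (con 1 :+ (e :+ y))) refl (w₁ * a) k e y ⟩
    w₁ * a + suc k * suc (e + y)             ≤⟨ ℕ.+-monoʳ-≤ (w₁ * a) (ℕ.*-monoʳ-≤ (suc k) e+y<b) ⟩
    w₁ * a + suc k * b                       ∎

-- Games with two types

module TwoTypeGame {n} (χ : Game n) (t : Fin n → Bool)
  (simple : IsSimpleGame χ) (types : IsTwoTypes χ t) where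

  n₁ n₂ : ℕ
  n₁ = count t
  n₂ = count (∁ t)

  monotone : ∀ {U V} → U ⊆c V → χ U ≡ true → χ V ≡ true
  monotone = proj₂ (proj₂ simple) _ _

  m₁≤n₁ : ∀ U → m₁ t U ≤ n₁
  m₁≤n₁ U = wsum-mono {n} (λ _ → 1) λ k e → proj₂ (∧≡true e)

  m₂≤n₂ : ∀ U → m₂ t U ≤ n₂
  m₂≤n₂ U = wsum-mono {n} (λ _ → 1) λ k e → proj₂ (∧≡true e)

  count≡m₁+m₂ : ∀ U → count U ≡ m₁ t U + m₂ t U
  count≡m₁+m₂ U = wsum-split {n} (λ _ → 1) U t

  desirable-by-type : ∀ {r p} → (t p ≡ true → t r ≡ true) → r ⊒[ χ ] p
  desirable-by-type {r} {p} type≥ with t r in tr | t p in tp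
  ... | true  | true  = proj₁ (Equivalence.from (proj₁ types r p) (trans tr (sym tp)))
  ... | false | false = proj₁ (Equivalence.from (proj₁ types r p) (trans tr (sym tp)))
  ... | true  | false = proj₂ (proj₂ (proj₂ types)) r p tr tp
  ... | false | true  = contradiction (type≥ refl) λ ()

  types-distinct : ∀ {i j} → t i ≡ true → t j ≡ false → ¬ (j ⊒[ χ ] i)
  types-distinct {i} {j} ti tj j⊒i =
    contradiction (trans (sym ti) (trans (Equivalence.to (proj₁ types i j) (desirable-by-type (λ _ → ti) , j⊒i)) tj)) λ ()

  m₁-exchange : ∀ U V → m₁ t U + m₁ t (V ∖ U) ≡ m₁ t V + m₁ t (U ∖ V)
  m₁-exchange U V = wsumℕ-⊕ {n} (λ _ → 1) (⊕-∩ {A = U} {V ∖ U} {V} {U ∖ V} t (⊕-∖-exchange U V))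

  count-exchange : ∀ U V → count U + count (V ∖ U) ≡ count V + count (U ∖ V)
  count-exchange U V = wsumℕ-⊕ {n} (λ _ → 1) (⊕-∖-exchange U V)

  m₁-gain : ∀ {U V p} → (U ∖ V) p ≡ true → t p ≡ false → count U ≤ count V →
    count ((V ∖ U) ∖ t) ≡ 0 → m₁ t (U ∖ V) < m₁ t (V ∖ U)
  m₁-gain {U} {V} {p} p∈ tp count≤ empty = begin-strict
    m₁ t (U ∖ V)                  <⟨ ℕ.m<m+n _ (wsum-member {n} (λ _ → 1) {(U ∖ V) ∖ t} (∧-intro p∈ (cong not tp))) ⟩
    m₁ t (U ∖ V) + m₂ t (U ∖ V)   ≡⟨ sym (count≡m₁+m₂ (U ∖ V)) ⟩
    count (U ∖ V)                 ≤⟨ ≤-balance (count-exchange U V) count≤ ⟩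
    count (V ∖ U)                 ≡⟨ count≡m₁+m₂ (V ∖ U) ⟩
    m₁ t (V ∖ U) + m₂ t (V ∖ U)   ≡⟨ cong (m₁ t (V ∖ U) +_) empty ⟩
    m₁ t (V ∖ U) + 0              ≡⟨ ℕ.+-identityʳ _ ⟩
    m₁ t (V ∖ U)                  ∎
    where open ℕ.≤-Reasoning

  replacement : ∀ {U V p} → U p ≡ true → V p ≡ false → m₁ t U ≤ m₁ t V → count U ≤ count V →
    ∃ λ r → (V ∖ U) r ≡ true × (t p ≡ true → t r ≡ true) × m₁ t U + ind (t r) ≤ m₁ t V + ind (t p)
  replacement {U} {V} {p} Up Vp m₁≤ count≤ with t p in tp
  ... | true with count-pos ((V ∖ U) ∩ t)
                   (ℕ.≤-trans (wsum-member {n} (λ _ → 1) {(U ∖ V) ∩ t} (∧-intro (∧-intro Up (cong not Vp)) tp))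
                              (≤-balance (m₁-exchange U V) m₁≤))
  ...   | r , r∈ = r , proj₁ (∧≡true r∈) , (λ _ → proj₂ (∧≡true r∈)) , step
    where
    step : m₁ t U + ind (t r) ≤ m₁ t V + 1
    step = subst (λ b → m₁ t U + ind b ≤ m₁ t V + 1) (sym (proj₂ (∧≡true {(V ∖ U) r} r∈))) (ℕ.+-monoˡ-≤ 1 m₁≤)
  replacement {U} {V} {p} Up Vp m₁≤ count≤ | false with count ((V ∖ U) ∖ t) in ec
  ... | suc _ with count-pos ((V ∖ U) ∖ t) (subst (1 ≤_) (sym ec) (s≤s z≤n))
  ...   | r , r∈ = r , proj₁ (∖≡true r∈) , (λ ()) , step
    where
    step : m₁ t U + ind (t r) ≤ m₁ t V + 0
    step = subst (λ b → m₁ t U + ind b ≤ m₁ t V + 0) (sym (proj₂ (∖≡true {(V ∖ U) r} r∈))) (ℕ.+-monoˡ-≤ 0 m₁≤)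
  replacement {U} {V} {p} Up Vp m₁≤ count≤ | false | zero
    with count-pos ((V ∖ U) ∩ t) (ℕ.≤-trans (s≤s z≤n) (m₁-gain (∧-intro Up (cong not Vp)) tp count≤ ec))
  ... | r , r∈ = r , proj₁ (∧≡true r∈) , (λ ()) , step
    where
    step : m₁ t U + ind (t r) ≤ m₁ t V + 0
    step = subst₂ (λ b c → m₁ t U + ind b ≤ c) (sym (proj₂ (∧≡true {(V ∖ U) r} r∈))) (sym (ℕ.+-identityʳ _))
      (subst (_≤ m₁ t V) (ℕ.+-comm 1 (m₁ t U))
             (<-balance (m₁-exchange U V) (m₁-gain (∧-intro Up (cong not Vp)) tp count≤ ec)))

  -- Replacing a member of U ∖ V by a suitable member of V ∖ U keeps U winning.
  dominance-by-excess : ∀ f {U V} → count (U ∖ V) ≡ f → m₁ t U ≤ m₁ t V → count U ≤ count V →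
    χ U ≡ true → χ V ≡ true
  dominance-by-excess zero {U} {V} none _ _ = monotone U⊆V
    where
    U⊆V : U ⊆c V
    U⊆V k Uk with V k in Vk
    ... | true  = refl
    ... | false = contradiction (trans (sym (count-zero (U ∖ V) none k)) (∧-intro Uk (cong not Vk))) λ ()
  dominance-by-excess (suc f) {U} {V} excess m₁≤ count≤ U-wins
    with count-pos (U ∖ V) (subst (1 ≤_) (sym excess) (s≤s z≤n))
  ... | p , p∈ with ∖≡true {U p} p∈
  ...   | Up , Vp with replacement Up Vp m₁≤ count≤
  ...     | r , r∈ , type≥ , gain with ∖≡true {V r} r∈
  ...       | Vr , Ur =
    dominance-by-excess f excess′ m₁≤′ count≤′ (desirable-by-type type≥ U Up Ur U-wins)
    where
    U′ : Coalition n
    U′ = swapIn r p U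
    m₁≤′ : m₁ t U′ ≤ m₁ t V
    m₁≤′ = ℕ.+-cancelʳ-≤ (ind (t p)) _ _ (subst (_≤ m₁ t V + ind (t p)) (sym (count-∩-swapIn {U = U} t Up Ur)) gain)
    count≤′ : count U′ ≤ count V
    count≤′ = subst (_≤ count V) (sym (count-swapIn U Up Ur)) count≤
    excess′ : count (U′ ∖ V) ≡ f
    excess′ = ℕ.+-cancelʳ-≡ 1 _ _ (begin
      count (U′ ∖ V) + 1              ≡⟨ cong (λ b → count (U′ ∖ V) + ind (not b)) (sym Vp) ⟩
      count (U′ ∖ V) + ind (not (V p)) ≡⟨ count-∩-swapIn {U = U} (∁ V) Up Ur ⟩
      count (U ∖ V) + ind (not (V r)) ≡⟨ cong₂ (λ c b → c + ind (not b)) excess Vr ⟩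
      suc f + 0                        ≡⟨ ℕ.+-comm (suc f) 0 ⟩
      suc f                            ≡⟨ ℕ.+-comm 1 f ⟩
      f + 1                            ∎)
      where open ≡-Reasoning

  dominance : ∀ {U V} → m₁ t U ≤ m₁ t V → count U ≤ count V → χ U ≡ true → χ V ≡ true
  dominance = dominance-by-excess _ refl

  -- Unlike unions, merges can be compared type by type (⊕-merge).
  merge : Coalition n → Coalition n → Coalition n
  merge P Q k = if t k then P k else Q k

  ⊕-merge : ∀ {P₁ P₂ P₃ P₄ Q₁ Q₂ Q₃ Q₄} → P₁ ⊕ P₂ ≗ P₃ ⊕ P₄ → Q₁ ⊕ Q₂ ≗ Q₃ ⊕ Q₄ →
    merge P₁ Q₁ ⊕ merge P₂ Q₂ ≗ merge P₃ Q₃ ⊕ merge P₄ Q₄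
  ⊕-merge eqP eqQ k with t k
  ... | true  = eqP k
  ... | false = eqQ k

  merge-≗ : ∀ {P Q} → P ⊆c t → Q ⊆c ∁ t → merge P Q ≗ P ∪ Q
  merge-≗ {P} {Q} P⊆ Q⊆ k with t k in tk | P k in Pk | Q k in Qk
  ... | true  | p     | true  = contradiction (trans (sym (Q⊆ k Qk)) (cong not tk)) λ ()
  ... | true  | p     | false = sym (Bool.∨-identityʳ p)
  ... | false | true  | _     = contradiction (trans (sym (P⊆ k Pk)) tk) λ ()
  ... | false | false | q     = refl

  merge-∅ʳ : ∀ {P} → P ⊆c t → merge P ∅c ≗ P
  merge-∅ʳ {P} P⊆ k = trans (merge-≗ P⊆ (λ _ ()) k) (Bool.∨-identityʳ (P k))

  merge-∅ˡ : ∀ {Q} → Q ⊆c ∁ t → merge ∅c Q ≗ Q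
  merge-∅ˡ Q⊆ = merge-≗ (λ _ ()) Q⊆

  m₁-merge : ∀ {P Q} → P ⊆c t → Q ⊆c ∁ t → m₁ t (merge P Q) ≡ count P
  m₁-merge {P} {Q} P⊆ Q⊆ = wsum-cong (λ _ → 1) merge∩t≗P
    where
    merge∩t≗P : merge P Q ∩ t ≗ P
    merge∩t≗P k with t k in tk | P k in Pk
    ... | true  | p     = Bool.∧-identityʳ p
    ... | false | true  = contradiction (trans (sym (P⊆ k Pk)) tk) λ ()
    ... | false | false = Bool.∧-zeroʳ (Q k)

  m₂-merge : ∀ {P Q} → P ⊆c t → Q ⊆c ∁ t → m₂ t (merge P Q) ≡ count Q
  m₂-merge {P} {Q} P⊆ Q⊆ = wsum-cong (λ _ → 1) merge∖t≗Q
    where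
    merge∖t≗Q : merge P Q ∖ t ≗ Q
    merge∖t≗Q k with t k in tk | Q k in Qk
    ... | false | q     = Bool.∧-identityʳ q
    ... | true  | true  = contradiction (trans (sym (Q⊆ k Qk)) (cong not tk)) λ ()
    ... | true  | false = Bool.∧-zeroʳ (P k)

  count-merge : ∀ {P Q} → P ⊆c t → Q ⊆c ∁ t → count (merge P Q) ≡ count P + count Q
  count-merge P⊆ Q⊆ = trans (count≡m₁+m₂ _) (cong₂ _+_ (m₁-merge P⊆ Q⊆) (m₂-merge P⊆ Q⊆))

  Realizable : Vec2 → Set
  Realizable v = v ≤² (n₁ , n₂)

  realizable-vector : ∀ U → Realizable (m₁ t U , m₂ t U)
  realizable-vector U = m₁≤n₁ U , m₂≤n₂ U

  WinVec-realizable : ∀ {v} → WinVec χ t v → Realizable v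
  WinVec-realizable {x , y} (U , refl , refl , _) = realizable-vector U

  canonical : Vec2 → Coalition n
  canonical (x , y) = merge (firstOf t x) (firstOf (∁ t) y)

  m₁-canonical : ∀ {x y} → Realizable (x , y) → m₁ t (canonical (x , y)) ≡ x
  m₁-canonical {x} {y} (x≤ , _) = trans (m₁-merge (firstOf-⊆ t x) (firstOf-⊆ (∁ t) y)) (count-firstOf t x≤)

  m₂-canonical : ∀ {x y} → Realizable (x , y) → m₂ t (canonical (x , y)) ≡ y
  m₂-canonical {x} {y} (_ , y≤) = trans (m₂-merge (firstOf-⊆ t x) (firstOf-⊆ (∁ t) y)) (count-firstOf (∁ t) y≤)

  count-canonical : ∀ {x y} → Realizable (x , y) → count (canonical (x , y)) ≡ x + y
  count-canonical r = trans (count≡m₁+m₂ _) (cong₂ _+_ (m₁-canonical r) (m₂-canonical r))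

  Wins : Vec2 → Set
  Wins v = χ (canonical v) ≡ true

  canonical-WinVec : ∀ {v} → Realizable v → Wins v → WinVec χ t v
  canonical-WinVec r w = canonical _ , m₁-canonical r , m₂-canonical r , w

  wins-if-dominated : ∀ {v′ v} → WinVec χ t v′ → v′ ⊑ v → Realizable v → Wins v
  wins-if-dominated {x′ , y′} {x , y} (U , refl , refl , U-wins) (x′≤x , s′≤s) r =
    dominance (subst (m₁ t U ≤_) (sym (m₁-canonical r)) x′≤x)
              (subst₂ _≤_ (sym (count≡m₁+m₂ U)) (sym (count-canonical r)) s′≤s) U-wins

  RealizableWin : Vec2 → Set
  RealizableWin v = Realizable v × Wins v

  realizableWin? : Decidable RealizableWin
  realizableWin? (x , y) = (x ℕ.≤? n₁ ×-dec y ℕ.≤? n₂) ×-dec (χ (canonical (x , y)) Bool.≟ true)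

  shift-minimal : ∀ {v} → RealizableWin v → ¬ (∃ λ u → Step u v × RealizableWin u) → IsShiftMinWin χ t v
  shift-minimal {v} (r , w) no-step = canonical-WinVec r w , minimal
    where
    minimal : ∀ v′ → WinVec χ t v′ → v′ ⪯ v → v′ ≡ v
    minimal v′ v′-wins v′⪯v with v′ ≟² v
    ... | yes v′≡v = v′≡v
    ... | no  v′≢v with ⊑-Step r (WinVec-realizable v′-wins) (⪯⇒⊑ v′⪯v) v′≢v
    ...   | u , s , ru , v′⊑u = contradiction (u , s , ru , wins-if-dominated v′-wins v′⊑u ru) no-step

  shift-minimal-below : ∀ {v} → RealizableWin v → ∃ λ m → IsShiftMinWin χ t m × m ⪯ v
  shift-minimal-below {v} = descend v (<-wellFounded (step-size v))
    where
    descend : ∀ v → Acc _<_ (step-size v) → RealizableWin v → ∃ λ m → IsShiftMinWin χ t m × m ⪯ v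
    descend v (acc smaller) rw with Step⁻¹? realizableWin? v
    ... | no  no-step          = v , shift-minimal rw no-step , ε
    ... | yes (u , s , rw-u) with descend u (smaller (Step⇒step-size< s)) rw-u
    ...   | m , m-min , m⪯u = m , m-min , m⪯u ◅◅ (s ◅ ε)

  wsum-typed : ∀ c₁ c₂ U → wsumℕ (λ i → if t i then c₁ else c₂) U ≡ c₁ * m₁ t U + c₂ * m₂ t U
  wsum-typed c₁ c₂ U = begin
    wsumℕ w U                                            ≡⟨ wsum-split w U t ⟩
    wsumℕ w (U ∩ t) + wsumℕ w (U ∖ t)                     ≡⟨ cong₂ _+_ (wsum-congʷ (U ∩ t) on-type₁) (wsum-congʷ (U ∖ t) on-type₂) ⟩
    wsumℕ (λ _ → c₁) (U ∩ t) + wsumℕ (λ _ → c₂) (U ∖ t)   ≡⟨ cong₂ _+_ (wsum-const c₁ (U ∩ t)) (wsum-const c₂ (U ∖ t)) ⟩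
    c₁ * m₁ t U + c₂ * m₂ t U                             ∎
    where
    open ≡-Reasoning
    w : Fin n → ℕ
    w i = if t i then c₁ else c₂
    on-type₁ : ∀ i → (U ∩ t) i ≡ true → w i ≡ c₁
    on-type₁ i e = cong (λ b → if b then c₁ else c₂) (proj₂ (∧≡true {U i} e))
    on-type₂ : ∀ i → (U ∖ t) i ≡ true → w i ≡ c₂
    on-type₂ i e = cong (λ b → if b then c₁ else c₂) (proj₂ (∖≡true {U i} e))

  module UniqueShiftMinimal (unique : ExactlyOneShiftMinWin χ t) where

    a b : ℕ
    a = proj₁ (proj₁ unique)
    b = proj₂ (proj₁ unique)

    wins⇒ : ∀ {U} → χ U ≡ true → a ≤ m₁ t U × a + b ≤ count U
    wins⇒ {U} U-wins
      with shift-minimal-below (r , wins-if-dominated (U , refl , refl , U-wins) (ℕ.≤-refl , ℕ.≤-refl) r)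
      where
      r : Realizable (m₁ t U , m₂ t U)
      r = realizable-vector U
    ... | m , m-min , m⪯U with ⪯⇒⊑ m⪯U | proj₂ (proj₂ unique) m m-min
    ...   | x≤ , s≤ | refl = x≤ , subst (a + b ≤_) (sym (count≡m₁+m₂ U)) s≤

    ⇒wins : ∀ {U} → a ≤ m₁ t U → a + b ≤ count U → χ U ≡ true
    ⇒wins {U} a≤ s≤ with proj₁ (proj₁ (proj₂ unique))
    ... | U₀ , m₁≡a , m₂≡b , U₀-wins =
      dominance (subst (_≤ m₁ t U) (sym m₁≡a) a≤)
                (subst (_≤ count U) (sym (trans (count≡m₁+m₂ U₀) (cong₂ _+_ m₁≡a m₂≡b))) s≤) U₀-wins

    m₁<⇒loses : ∀ {U} → m₁ t U < a → χ U ≡ false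
    m₁<⇒loses m₁< = Bool.¬-not λ U-wins → ℕ.<⇒≱ m₁< (proj₁ (wins⇒ U-wins))

    count<⇒loses : ∀ {U} → count U < a + b → χ U ≡ false
    count<⇒loses count< = Bool.¬-not λ U-wins → ℕ.<⇒≱ count< (proj₂ (wins⇒ U-wins))

    loses⇒ : ∀ {U} → χ U ≡ false → m₁ t U < a ⊎ count U < a + b
    loses⇒ {U} U-loses with a ℕ.≤? m₁ t U | (a + b) ℕ.≤? count U
    ... | yes a≤ | yes s≤ = contradiction (trans (sym (⇒wins a≤ s≤)) U-loses) λ ()
    ... | no  a≰ | _      = inj₁ (ℕ.≰⇒> a≰)
    ... | yes _  | no s≰  = inj₂ (ℕ.≰⇒> s≰)

    -- Otherwise winning would depend on the number of members only,
    -- making both types equally desirable.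
    count-decides⇒⊥ : (∀ {U} → a + b ≤ count U → a ≤ m₁ t U) → ⊥
    count-decides⇒⊥ count-decides = types-distinct (proj₂ i) (proj₂ j) j⊒i
      where
      i : ∃ λ i → t i ≡ true
      i = proj₁ (proj₂ types)
      j : ∃ λ j → t j ≡ false
      j = proj₁ (proj₂ (proj₂ types))
      j⊒i : proj₁ j ⊒[ χ ] proj₁ i
      j⊒i U Ui Uj U-wins = ⇒wins (count-decides s≤) s≤
        where
        s≤ : a + b ≤ count (swapIn (proj₁ j) (proj₁ i) U)
        s≤ = subst (a + b ≤_) (sym (count-swapIn U Ui Uj)) (proj₂ (wins⇒ U-wins))

    1≤a : 1 ≤ a
    1≤a with 1 ℕ.≤? a
    ... | yes 1≤a = 1≤a
    ... | no  1≰a = ⊥-elim (count-decides⇒⊥ λ {U} _ → subst (_≤ m₁ t U) (sym (ℕ.n<1⇒n≡0 (ℕ.≰⇒> 1≰a))) z≤n)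

    b<n₂ : b < n₂
    b<n₂ with b ℕ.<? n₂
    ... | yes b<n₂ = b<n₂
    ... | no  b≮n₂ = ⊥-elim (count-decides⇒⊥ count-decides)
      where
      count-decides : ∀ {U} → a + b ≤ count U → a ≤ m₁ t U
      count-decides {U} s≤ = ℕ.+-cancelʳ-≤ b a (m₁ t U) (begin
        a + b           ≤⟨ s≤ ⟩
        count U         ≡⟨ count≡m₁+m₂ U ⟩
        m₁ t U + m₂ t U ≤⟨ ℕ.+-monoʳ-≤ (m₁ t U) (ℕ.≤-trans (m₂≤n₂ U) (ℕ.≮⇒≥ b≮n₂)) ⟩
        m₁ t U + b      ∎)
        where open ℕ.≤-Reasoning

    d k : ℕ
    d = n₂ ∸ b
    k = (n₁ ∸ a) ⊓ (b ∸ 1)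

    -- Moving one type-1 player out of, resp. into, a coalition of vector (a , b) against two
    -- type-2 players gives two losing coalitions trading against two winning ones.
    module Trade (x y : ℕ) (a≡ : a ≡ suc x) (b≡ : b ≡ suc (suc y)) (a<n₁ : a < n₁) (b+2≤n₂ : b + 2 ≤ n₂) where

      X Y : ℕ → Coalition n
      X = firstOf t
      Y = firstOf (∁ t)

      L₁ L₂ W₁ W₂ : Coalition n
      L₁ = canonical (x , b + 2)
      L₂ = canonical (suc a , y)
      W₁ = canonical (a , b)
      W₂ = merge (X x ∪ (X (suc a) ∖ X a)) (Y y ∪ (Y (b + 2) ∖ Y b))

      trade : L₁ ⊕ L₂ ≗ W₁ ⊕ W₂
      trade = ⊕-merge (⊕-chain (firstOf-mono t x≤a) (firstOf-mono t (ℕ.n≤1+n a)))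
                      (λ i → trans (ℕ.+-comm (ind (Y (b + 2) i)) _)
                                   (⊕-chain (firstOf-mono (∁ t) y≤b) (firstOf-mono (∁ t) (ℕ.m≤m+n b 2)) i))
        where
        x≤a : x ≤ a
        x≤a = ℕ.≤-trans (ℕ.n≤1+n x) (ℕ.≤-reflexive (sym a≡))
        y≤b : y ≤ b
        y≤b = ℕ.≤-trans (ℕ.≤-trans (ℕ.n≤1+n y) (ℕ.n≤1+n (suc y))) (ℕ.≤-reflexive (sym b≡))

      x<a : x < a
      x<a = ℕ.≤-reflexive (sym a≡)

      realizable-W₁ : Realizable (a , b)
      realizable-W₁ = ℕ.<⇒≤ a<n₁ , ℕ.≤-trans (ℕ.m≤m+n b 2) b+2≤n₂

      realizable-L₁ : Realizable (x , b + 2)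
      realizable-L₁ = ℕ.≤-trans (ℕ.<⇒≤ x<a) (ℕ.<⇒≤ a<n₁) , b+2≤n₂

      realizable-L₂ : Realizable (suc a , y)
      realizable-L₂ = a<n₁ , ℕ.≤-trans (ℕ.m≤n+m y 2) (ℕ.≤-trans (ℕ.≤-reflexive (sym b≡)) (proj₂ realizable-W₁))

      m₁-W₂ : m₁ t W₂ ≡ a
      m₁-W₂ = ℕ.+-cancelˡ-≡ a _ _ (begin
        a + m₁ t W₂          ≡⟨ cong (_+ m₁ t W₂) (m₁-canonical realizable-W₁) ⟨
        m₁ t W₁ + m₁ t W₂    ≡⟨ wsumℕ-⊕ {n} (λ _ → 1) (⊕-∩ {A = L₁} {L₂} {W₁} {W₂} t trade) ⟨
        m₁ t L₁ + m₁ t L₂    ≡⟨ cong₂ _+_ (m₁-canonical realizable-L₁) (m₁-canonical realizable-L₂) ⟩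
        x + suc a            ≡⟨ ℕ.+-suc x a ⟩
        suc x + a            ≡⟨ cong (_+ a) (sym a≡) ⟩
        a + a                ∎)
        where open ≡-Reasoning

      count-W₂ : count W₂ ≡ a + b
      count-W₂ = ℕ.+-cancelˡ-≡ (a + b) _ _ (begin
        (a + b) + count W₂                ≡⟨ cong (_+ count W₂) (count-canonical realizable-W₁) ⟨
        count W₁ + count W₂                ≡⟨ wsumℕ-⊕ {n} (λ _ → 1) {L₁} {L₂} {W₁} {W₂} trade ⟨
        count L₁ + count L₂                ≡⟨ cong₂ _+_ (count-canonical realizable-L₁) (count-canonical realizable-L₂) ⟩
        (x + (b + 2)) + (suc a + y)        ≡⟨ balanced a≡ b≡ ⟩
        (a + b) + (a + b)                  ∎)
        where
        open ≡-Reasoning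
        balanced : ∀ {a b} → a ≡ suc x → b ≡ suc (suc y) → (x + (b + 2)) + (suc a + y) ≡ (a + b) + (a + b)
        balanced refl refl = solve 2 (λ x y → (x :+ ((con 2 :+ y) :+ con 2)) :+ ((con 2 :+ x) :+ y)
                                           := ((con 1 :+ x) :+ (con 2 :+ y)) :+ ((con 1 :+ x) :+ (con 2 :+ y))) refl x y

      impossible : IsWeighted χ → ⊥
      impossible weighted = weighted⇒no-trade weighted trade L₁-loses L₂-loses W₁-wins W₂-wins
        where
        L₁-loses : χ L₁ ≡ false
        L₁-loses = m₁<⇒loses (subst (_< a) (sym (m₁-canonical realizable-L₁)) x<a)
        L₂-loses : χ L₂ ≡ false
        L₂-loses = count<⇒loses (subst (_< a + b) (sym (count-canonical realizable-L₂))
          (ℕ.≤-reflexive (sym (trans (cong (a +_) b≡) (trans (ℕ.+-suc a (suc y)) (cong suc (ℕ.+-suc a y)))))))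
        W₁-wins : χ W₁ ≡ true
        W₁-wins = ⇒wins (ℕ.≤-reflexive (sym (m₁-canonical realizable-W₁)))
                        (ℕ.≤-reflexive (sym (count-canonical realizable-W₁)))
        W₂-wins : χ W₂ ≡ true
        W₂-wins = ⇒wins (ℕ.≤-reflexive (sym m₁-W₂)) (ℕ.≤-reflexive (sym count-W₂))

    a≤n₁ : a ≤ n₁
    a≤n₁ with proj₁ (proj₁ (proj₂ unique))
    ... | U₀ , m₁≡a , _ = subst (_≤ n₁) m₁≡a (m₁≤n₁ U₀)

    1≤d : 1 ≤ d
    1≤d = ℕ.m<n⇒0<n∸m b<n₂

    b+d≡n₂ : b + d ≡ n₂
    b+d≡n₂ = ℕ.m+[n∸m]≡n (ℕ.<⇒≤ b<n₂)

    d≡1 : IsWeighted χ → 1 ≤ k → d ≡ 1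
    d≡1 weighted 1≤k with 2 ℕ.≤? d
    ... | no  2≰d = ℕ.≤-antisym (ℕ.≤-pred (ℕ.≰⇒> 2≰d)) 1≤d
    ... | yes 2≤d = ⊥-elim (Trade.impossible (a ∸ 1) (b ∸ 2) (sym (ℕ.m+[n∸m]≡n 1≤a)) (sym (ℕ.m+[n∸m]≡n 2≤b))
                                             a<n₁ b+2≤n₂ weighted)
      where
      a<n₁ : a < n₁
      a<n₁ = ℕ.m∸n≢0⇒n<m (ℕ.n>0⇒n≢0 (ℕ.≤-trans 1≤k (ℕ.m⊓n≤m (n₁ ∸ a) (b ∸ 1))))
      2≤b : 2 ≤ b
      2≤b = ℕ.m∸n≢0⇒n<m (ℕ.n>0⇒n≢0 (ℕ.≤-trans 1≤k (ℕ.m⊓n≤n (n₁ ∸ a) (b ∸ 1))))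
      b+2≤n₂ : b + 2 ≤ n₂
      b+2≤n₂ = ℕ.≤-trans (ℕ.+-monoʳ-≤ b 2≤d) (ℕ.≤-reflexive b+d≡n₂)

    private
      type₂-weight : ℕ → ℕ
      type₂-weight zero    = 0
      type₂-weight (suc _) = suc k

    W₁ W₂ q : ℕ
    W₂ = type₂-weight b
    W₁ = W₂ * d + 1
    q  = W₁ * a + W₂ * b

    weight : Fin n → ℕ
    weight i = if t i then W₁ else W₂

    W₂≡ : 1 ≤ b → W₂ ≡ suc k
    W₂≡ = lemma
      where
      lemma : ∀ {m} → 1 ≤ m → type₂-weight m ≡ suc k
      lemma (s≤s _) = refl

    W₂≤W₁ : W₂ ≤ W₁
    W₂≤W₁ = ℕ.≤-trans (ℕ.≤-trans (ℕ.≤-reflexive (sym (ℕ.*-identityʳ W₂))) (ℕ.*-monoʳ-≤ W₂ 1≤d)) (ℕ.m≤m+n (W₂ * d) 1)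

    -- For e ≥ 1 also k ≥ 1, hence d = 1 and W₁ = k + 2.
    W₁-excess : IsWeighted χ → ∀ {e} → e ≤ k → W₁ * e ≤ suc k * e + k
    W₁-excess weighted {zero}  _   = subst (_≤ suc k * 0 + k) (sym (ℕ.*-zeroʳ W₁)) z≤n
    W₁-excess weighted {suc e} e<k = begin
      W₁ * suc e              ≡⟨ cong (_* suc e) W₁≡ ⟩
      (suc k + 1) * suc e     ≡⟨ ℕ.*-distribʳ-+ (suc e) (suc k) 1 ⟩
      suc k * suc e + 1 * suc e ≡⟨ cong (suc k * suc e +_) (ℕ.*-identityˡ (suc e)) ⟩
      suc k * suc e + suc e   ≤⟨ ℕ.+-monoʳ-≤ (suc k * suc e) e<k ⟩
      suc k * suc e + k       ∎
      where
      open ℕ.≤-Reasoning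
      1≤k : 1 ≤ k
      1≤k = ℕ.≤-trans (s≤s z≤n) e<k
      W₁≡ : W₁ ≡ suc k + 1
      W₁≡ = trans (cong₂ (λ w₂ d → w₂ * d + 1) (W₂≡ 1≤b) (d≡1 weighted 1≤k)) (cong (_+ 1) (ℕ.*-identityʳ (suc k)))
        where
        1≤b : 1 ≤ b
        1≤b = ℕ.≤-trans 1≤k (ℕ.≤-trans (ℕ.m⊓n≤n (n₁ ∸ a) (b ∸ 1)) (ℕ.m∸n≤m b 1))

    fewer-members-light : IsWeighted χ → ∀ {e y} → e ≤ k → suc (e + y) ≤ b →
      W₁ * (a + e) + W₂ * y < W₁ * a + W₂ * b
    fewer-members-light weighted {e} {y} e≤k e+y<b =
      subst (λ w₂ → W₁ * (a + e) + w₂ * y < W₁ * a + w₂ * b) (sym (W₂≡ (ℕ.≤-trans (s≤s z≤n) e+y<b)))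
            (weigh-fewer-members W₁ k a (W₁-excess weighted e≤k) e+y<b)

    representation : IsWeighted χ → IsIntRep χ q weight
    representation weighted U = wins-heavy , loses-light
      where
      x y : ℕ
      x = m₁ t U
      y = m₂ t U
      weight-U : wsumℕ weight U ≡ W₁ * x + W₂ * y
      weight-U = wsum-typed W₁ W₂ U
      weight-U′ : a ≤ x → wsumℕ weight U ≡ W₁ * (a + (x ∸ a)) + W₂ * y
      weight-U′ a≤x = trans weight-U (cong (λ z → W₁ * z + W₂ * y) (sym (ℕ.m+[n∸m]≡n a≤x)))
      count-U : a ≤ x → count U ≡ a + ((x ∸ a) + y)
      count-U a≤x = trans (count≡m₁+m₂ U) (trans (cong (_+ y) (sym (ℕ.m+[n∸m]≡n a≤x))) (ℕ.+-assoc a (x ∸ a) y))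

      wins-heavy : χ U ≡ true → q ≤ wsumℕ weight U
      wins-heavy U-wins with wins⇒ U-wins
      ... | a≤x , s≤ = subst (q ≤_) (sym (weight-U′ a≤x)) (weigh-shift a (x ∸ a) y W₂≤W₁ b≤)
        where
        b≤ : b ≤ (x ∸ a) + y
        b≤ = ℕ.+-cancelˡ-≤ a _ _ (ℕ.≤-trans s≤ (ℕ.≤-reflexive (count-U a≤x)))

      loses-light : χ U ≡ false → wsumℕ weight U < q
      loses-light U-loses with a ℕ.≤? x | loses⇒ U-loses
      ... | no a≰x  | _           = subst (_< q) (sym weight-U)
                       (weigh-fewer-type₁ W₂ d (ℕ.≰⇒> a≰x) (ℕ.≤-trans (m₂≤n₂ U) (ℕ.≤-reflexive (sym b+d≡n₂))))
      ... | yes a≤x | inj₁ x<a    = contradiction a≤x (ℕ.<⇒≱ x<a)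
      ... | yes a≤x | inj₂ count< = subst (_< q) (sym (weight-U′ a≤x)) (fewer-members-light weighted e≤k e+y<b)
        where
        e+y<b : suc ((x ∸ a) + y) ≤ b
        e+y<b = ℕ.+-cancelˡ-≤ a _ _ (subst (_≤ a + b) (trans (cong suc (count-U a≤x)) (sym (ℕ.+-suc a _))) count<)
        e≤k : x ∸ a ≤ k
        e≤k = ℕ.⊓-glb (ℕ.∸-monoˡ-≤ a (m₁≤n₁ U))
                      (ℕ.m+n≤o⇒m≤o∸n (x ∸ a) (ℕ.≤-trans (ℕ.≤-reflexive (ℕ.+-comm (x ∸ a) 1))
                                                       (ℕ.≤-trans (s≤s (ℕ.m≤m+n (x ∸ a) y)) e+y<b)))

    module Around (j : Fin n) (tj : t j ≡ true) (Q : Coalition n) (Q⊆ : Q ⊆c ∁ t) (count-Q : count Q ≡ b) where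

      T P W : Coalition n
      T = firstOf (t ∖ ⁅ j ⁆) (a ∸ 1)
      P = ⁅ j ⁆ ∪ T
      W = merge P Q

      T⊆t : T ⊆c t
      T⊆t i e = proj₁ (∖≡true (firstOf-⊆ (t ∖ ⁅ j ⁆) (a ∸ 1) i e))

      P⊆t : P ⊆c t
      P⊆t i e with ⁅ j ⁆ i in ji
      ... | true  = subst (λ i → t i ≡ true) (sym (⁅⁆-sole ji)) tj
      ... | false = T⊆t i e

      j∉T : Disjoint ⁅ j ⁆ T
      j∉T i ji = Bool.¬-not λ Ti →
        contradiction (trans (sym ji) (proj₂ (∖≡true (firstOf-⊆ (t ∖ ⁅ j ⁆) (a ∸ 1) i Ti)))) λ ()

      count-T : count T ≡ a ∸ 1
      count-T = count-firstOf (t ∖ ⁅ j ⁆) (ℕ.≤-pred (subst (suc (a ∸ 1) ≤_) (count-without {X = t} tj)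
                  (ℕ.≤-trans (ℕ.≤-reflexive (ℕ.m+[n∸m]≡n 1≤a)) a≤n₁)))

      count-P : count P ≡ a
      count-P = trans (wsum-∪ (λ _ → 1) j∉T) (trans (cong₂ _+_ (wsum-⁅⁆ (λ _ → 1) j) count-T) (ℕ.m+[n∸m]≡n 1≤a))

      W-wins : χ W ≡ true
      W-wins = ⇒wins (ℕ.≤-reflexive (sym (trans (m₁-merge P⊆t Q⊆) count-P)))
                     (ℕ.≤-reflexive (sym (trans (count-merge P⊆t Q⊆) (cong₂ _+_ count-P count-Q))))

      j∈W : W j ≡ true
      j∈W = trans (cong (λ b → if b then P j else Q j) tj) (cong (_∨ T j) (⁅⁆-self j))

    module Type₂Exchange (i : Fin n) (ti : t i ≡ false) (1≤b : 1 ≤ b) where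

      open ≡-Reasoning

      X V : ℕ → Coalition n
      X = firstOf t
      S : Coalition n
      S = ∁ t ∖ ⁅ i ⁆
      V = firstOf S
      b₁ : ℕ
      b₁ = b ∸ 1

      b≤count-S : b ≤ count S
      b≤count-S = ℕ.≤-pred (subst (suc b ≤_) (count-without {X = ∁ t} (cong not ti)) b<n₂)
      b₁≤ : b₁ ≤ count S
      b₁≤ = ℕ.≤-trans (ℕ.m∸n≤m b 1) b≤count-S
      k≤b₁ : k ≤ b₁
      k≤b₁ = ℕ.m⊓n≤n (n₁ ∸ a) b₁
      k≤ : k ≤ count S
      k≤ = ℕ.≤-trans k≤b₁ b₁≤
      a+k≤n₁ : a + k ≤ n₁
      a+k≤n₁ = ℕ.≤-trans (ℕ.+-monoʳ-≤ a (ℕ.m⊓n≤m (n₁ ∸ a) b₁)) (ℕ.≤-reflexive (ℕ.m+[n∸m]≡n a≤n₁))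
      count-V : ∀ {m} → m ≤ count S → count (V m) ≡ m
      count-V = count-firstOf S

      V⊆ : ∀ m → V m ⊆c ∁ t
      V⊆ m v e = proj₁ (∖≡true (firstOf-⊆ S m v e))
      i∉V : ∀ m → Disjoint ⁅ i ⁆ (V m)
      i∉V m v iv = Bool.¬-not λ Vv → contradiction (trans (sym (∖⁅⁆-self (∁ t) i))
                                                           (subst (λ u → S u ≡ true) (⁅⁆-sole iv) (firstOf-⊆ S m v Vv))) λ ()
      ⁅i⁆∪V⊆ : ∀ m → (⁅ i ⁆ ∪ V m) ⊆c ∁ t
      ⁅i⁆∪V⊆ m v e with ⁅ i ⁆ v in iv
      ... | true  = subst (λ u → (∁ t) u ≡ true) (sym (⁅⁆-sole iv)) (cong not ti)
      ... | false = V⊆ m v e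

      J′ B′ : Coalition n
      J′ = X (a + k) ∖ X a
      B′ = ⁅ i ⁆ ∪ V k
      J′⊆t : J′ ⊆c t
      J′⊆t v e = firstOf-⊆ t (a + k) v (proj₁ (∖≡true e))
      B′⊆ : B′ ⊆c ∁ t
      B′⊆ = ⁅i⁆∪V⊆ k
      count-J′ : count J′ ≡ k
      count-J′ = ℕ.+-cancelˡ-≡ a _ _ (trans (cong (_+ count J′) (sym (count-firstOf t a≤n₁)))
        (trans (sym (wsum-∖ (λ _ → 1) (firstOf-mono t (ℕ.m≤m+n a k)))) (count-firstOf t a+k≤n₁)))

      W J L B : Coalition n
      W = merge (X a) (⁅ i ⁆ ∪ V b₁)
      J = merge J′ ∅c
      L = merge (X (a + k)) (V b₁ ∖ V k)
      B = merge ∅c B′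

      exchange : W ⊕ J ≗ L ⊕ B
      exchange = ⊕-merge (λ v → sym (⊕-∖ (firstOf-mono t (ℕ.m≤m+n a k)) v)) (⊕-∪-∖ (i∉V b₁) (firstOf-mono S k≤b₁))

      W-wins : χ W ≡ true
      W-wins = ⇒wins (ℕ.≤-reflexive (sym (trans (m₁-merge (firstOf-⊆ t a) (⁅i⁆∪V⊆ b₁)) (count-firstOf t a≤n₁))))
        (ℕ.≤-reflexive (sym (begin
          count W                          ≡⟨ count-merge (firstOf-⊆ t a) (⁅i⁆∪V⊆ b₁) ⟩
          count (X a) + count (⁅ i ⁆ ∪ V b₁) ≡⟨ cong₂ _+_ (count-firstOf t a≤n₁) (wsum-∪ (λ _ → 1) (i∉V b₁)) ⟩
          a + (count ⁅ i ⁆ + count (V b₁))   ≡⟨ cong (λ c → a + (c + count (V b₁))) (wsum-⁅⁆ (λ _ → 1) i) ⟩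
          a + suc (count (V b₁))            ≡⟨ cong (λ c → a + suc c) (count-V b₁≤) ⟩
          a + suc b₁                        ≡⟨ cong (a +_) (ℕ.m+[n∸m]≡n 1≤b) ⟩
          a + b                             ∎)))

      L-loses : χ L ≡ false
      L-loses = count<⇒loses (ℕ.≤-reflexive (begin
        suc (count L)                              ≡⟨ cong suc (count-merge (firstOf-⊆ t (a + k)) V∖V⊆) ⟩
        suc (count (X (a + k)) + count (V b₁ ∖ V k)) ≡⟨ cong (λ c → suc (c + count (V b₁ ∖ V k))) (count-firstOf t a+k≤n₁) ⟩
        suc (a + k + count (V b₁ ∖ V k))           ≡⟨ cong suc (ℕ.+-assoc a k _) ⟩
        suc (a + (k + count (V b₁ ∖ V k)))         ≡⟨ cong (λ c → suc (a + (c + count (V b₁ ∖ V k)))) (count-V k≤) ⟨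
        suc (a + (count (V k) + count (V b₁ ∖ V k))) ≡⟨ cong (λ c → suc (a + c)) (wsum-∖ (λ _ → 1) (firstOf-mono S k≤b₁)) ⟨
        suc (a + count (V b₁))                     ≡⟨ cong (λ c → suc (a + c)) (count-V b₁≤) ⟩
        suc (a + b₁)                               ≡⟨ ℕ.+-suc a b₁ ⟨
        a + suc b₁                                 ≡⟨ cong (a +_) (ℕ.m+[n∸m]≡n 1≤b) ⟩
        a + b                                      ∎))
        where
        V∖V⊆ : (V b₁ ∖ V k) ⊆c ∁ t
        V∖V⊆ v e = V⊆ b₁ v (proj₁ (∖≡true e))

    module Swap {j x} (tj : t j ≡ true) (tx : t x ≡ false) where

      S Q : Coalition n
      S = ∁ t ∖ ⁅ x ⁆
      Q = firstOf S b
      Q⊆ : Q ⊆c ∁ t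
      Q⊆ i e = proj₁ (∖≡true (firstOf-⊆ S b i e))
      count-Q : count Q ≡ b
      count-Q = count-firstOf S (ℕ.≤-pred (subst (suc b ≤_) (count-without {X = ∁ t} (cong not tx)) b<n₂))
      open Around j tj Q Q⊆ count-Q public
      x∉W : W x ≡ false
      x∉W = trans (cong (λ b → if b then P x else Q x) tx)
                  (Bool.¬-not λ Qx → contradiction (trans (sym (∖⁅⁆-self (∁ t) x)) (firstOf-⊆ S b x Qx)) λ ())
      L : Coalition n
      L = swapIn x j W
      L-loses : χ L ≡ false
      L-loses = m₁<⇒loses (ℕ.≤-reflexive (begin
        suc (m₁ t L)         ≡⟨ ℕ.+-comm 1 (m₁ t L) ⟩
        m₁ t L + 1           ≡⟨ cong (λ b → m₁ t L + ind b) (sym tj) ⟩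
        m₁ t L + ind (t j)   ≡⟨ count-∩-swapIn {U = W} t j∈W x∉W ⟩
        m₁ t W + ind (t x)   ≡⟨ cong₂ (λ m b → m + ind b) (trans (m₁-merge P⊆t Q⊆) count-P) tx ⟩
        a + 0                ≡⟨ ℕ.+-identityʳ a ⟩
        a                    ∎))
        where open ≡-Reasoning

    module Type₁Exchange (j : Fin n) (tj : t j ≡ true) where

      Q : Coalition n
      Q = firstOf (∁ t) b
      Q⊆ : Q ⊆c ∁ t
      Q⊆ = firstOf-⊆ (∁ t) b
      open Around j tj Q Q⊆ (count-firstOf (∁ t) (ℕ.<⇒≤ b<n₂)) public

      D′ : Coalition n
      D′ = ∁ t ∖ Q
      D′⊆ : D′ ⊆c ∁ t
      D′⊆ i e = proj₁ (∖≡true e)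
      count-D′ : count D′ ≡ d
      count-D′ = ℕ.+-cancelˡ-≡ b _ _ (trans (cong (_+ count D′) (sym (count-firstOf (∁ t) (ℕ.<⇒≤ b<n₂))))
                                            (trans (sym (wsum-∖ (λ _ → 1) Q⊆)) (sym b+d≡n₂)))
      ⁅j⁆⊆t : ⁅ j ⁆ ⊆c t
      ⁅j⁆⊆t i e = subst (λ u → t u ≡ true) (sym (⁅⁆-sole e)) tj

      D L J : Coalition n
      D = merge ∅c D′
      L = merge T (∁ t)
      J = merge ⁅ j ⁆ ∅c

      exchange : W ⊕ D ≗ L ⊕ J
      exchange = ⊕-merge (λ i → trans (⊕-∪ j∉T i) (ℕ.+-comm (ind (⁅ j ⁆ i)) _)) (λ i → sym (⊕-∖ Q⊆ i))

      L-loses : χ L ≡ false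
      L-loses = m₁<⇒loses (subst (_< a) (sym (trans (m₁-merge T⊆t (λ _ e → e)) count-T))
                                (ℕ.≤-reflexive (ℕ.m+[n∸m]≡n 1≤a)))

    module Minimal {q′ w′} (rep′ : IsIntRep χ q′ w′) where

      type₂-lighter : ∀ {j x} → t j ≡ true → t x ≡ false → w′ x < w′ j
      type₂-lighter {j} {x} tj tx =
        subst₂ _<_ (wsum-⁅⁆ w′ x) (wsum-⁅⁆ w′ j)
          (int-rep-exchange rep′ {W} {⁅ x ⁆} {L} {⁅ j ⁆} (λ i → sym (⊕-swapIn {U = W} j∈W x∉W i)) W-wins L-loses)
        where open Swap tj tx

      -- The k type-1 players traded away weigh at least ν each, the k type-2 players received
      -- at most ν - 1 each, where ν is the least type-1 weight.
      type₂-heavy : ∀ {i} → t i ≡ false → 1 ≤ b → suc k ≤ w′ i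
      type₂-heavy {i} ti 1≤b with least-in t w′
      ... | inj₁ none = contradiction (trans (sym (proj₂ (proj₁ (proj₂ types)))) (none _)) λ ()
      ... | inj₂ (j₀ , tj₀ , least) = ℕ.+-cancelʳ-≤ (μ * k) (suc k) (w′ i) (begin
        suc (suc μ * k)            ≡⟨ cong (λ ν → suc (ν * k)) ν≡ ⟩
        suc (ν * k)                ≤⟨ s≤s (subst (λ c → ν * c ≤ wsumℕ w′ J′) count-J′ (wsum-lower J′ above-ν)) ⟩
        suc (wsumℕ w′ J′)          ≡⟨ cong suc (wsum-cong w′ (merge-∅ʳ J′⊆t)) ⟨
        suc (wsumℕ w′ J)           ≤⟨ int-rep-exchange rep′ {W} {J} {L} {B} exchange W-wins L-loses ⟩
        wsumℕ w′ B                 ≡⟨ wsum-cong w′ (merge-∅ˡ B′⊆) ⟩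
        wsumℕ w′ (⁅ i ⁆ ∪ V k)     ≡⟨ wsum-∪ w′ (i∉V k) ⟩
        wsumℕ w′ ⁅ i ⁆ + wsumℕ w′ (V k) ≤⟨ ℕ.+-mono-≤ (ℕ.≤-reflexive (wsum-⁅⁆ w′ i))
                                           (subst (λ c → wsumℕ w′ (V k) ≤ μ * c) (count-V k≤) (wsum-upper (V k) below-μ)) ⟩
        w′ i + μ * k               ∎)
        where
        open ℕ.≤-Reasoning
        open Type₂Exchange i ti 1≤b
        ν μ : ℕ
        ν = w′ j₀
        μ = pred ν
        ν≡ : suc μ ≡ ν
        ν≡ = lemma (ℕ.≤-trans (s≤s z≤n) (type₂-lighter tj₀ ti))
          where
          lemma : ∀ {m} → 1 ≤ m → suc (pred m) ≡ m
          lemma (s≤s _) = refl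

        above-ν : ∀ v → J′ v ≡ true → ν ≤ w′ v
        above-ν v e = least v (J′⊆t v e)
        below-μ : ∀ v → V k v ≡ true → w′ v ≤ μ
        below-μ v e = ℕ.≤-pred (subst (suc (w′ v) ≤_) (sym ν≡) (type₂-lighter tj₀ (not≡true (V⊆ k v e))))

      W₂≤ : ∀ {i} → t i ≡ false → W₂ ≤ w′ i
      W₂≤ {i} ti with 1 ℕ.≤? b
      ... | yes 1≤b = subst (_≤ w′ i) (sym (W₂≡ 1≤b)) (type₂-heavy ti 1≤b)
      ... | no  1≰b = subst (λ m → type₂-weight m ≤ w′ i) (sym (ℕ.n<1⇒n≡0 (ℕ.≰⇒> 1≰b))) z≤n

      W₁≤ : ∀ {j} → t j ≡ true → W₁ ≤ w′ j
      W₁≤ {j} tj = subst (_≤ w′ j) (ℕ.+-comm 1 (W₂ * d)) (begin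
        suc (W₂ * d)                 ≤⟨ s≤s (subst (λ c → W₂ * c ≤ wsumℕ w′ D′) count-D′ (wsum-lower D′ above-W₂)) ⟩
        suc (wsumℕ w′ D′)            ≡⟨ cong suc (wsum-cong w′ (merge-∅ˡ D′⊆)) ⟨
        suc (wsumℕ w′ D)             ≤⟨ int-rep-exchange rep′ {W} {D} {L} {J} exchange W-wins L-loses ⟩
        wsumℕ w′ J                   ≡⟨ wsum-cong w′ (merge-∅ʳ ⁅j⁆⊆t) ⟩
        wsumℕ w′ ⁅ j ⁆               ≡⟨ wsum-⁅⁆ w′ j ⟩
        w′ j                         ∎)
        where
        open ℕ.≤-Reasoning
        open Type₁Exchange j tj
        above-W₂ : ∀ i → D′ i ≡ true → W₂ ≤ w′ i
        above-W₂ i e = W₂≤ (not≡true (proj₁ (∖≡true e)))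

      minimal : ∀ i → weight i ≤ w′ i
      minimal i with t i in ti
      ... | true  = W₁≤ ti
      ... | false = W₂≤ ti

mainTheorem2 : ∀ {n} (χ : Game n) (t : Fin n → Bool) →
    IsSimpleGame χ → IsWeighted χ → IsTwoTypes χ t →
    ExactlyOneShiftMinWin χ t →
    Σ ℕ (λ q → Σ (Fin n → ℕ) (λ w → IsMinIntRep χ q w ×
    (∀ q' w' → IsMinIntRep χ q' w' → ∀ i → w' i ≡ w i)))
mainTheorem2 χ t simple weighted types unique =
  q , weight , minimum , λ _ _ minimum′ → min-int-rep-unique minimum minimum′
  where
  open TwoTypeGame χ t simple types
  open UniqueShiftMinimal unique
  minimum : IsMinIntRep χ q weight
  minimum = representation weighted , λ _ _ rep′ → Minimal.minimal rep′
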